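{- Let $G$ be a connected graph that does not contain the diamond as a contraction. Then every cycle $C$ of $G$ either is an induced cycle of $G$ (i.e. $C$ has no chord in $G$) or its vertex set induces a complete graph in $G$.
   Context: Graphs are finite, simple. Contracting an edge $\{u,v\}$ means adding a new vertex adjacent to all neighbours of $u$ and $v$ and deleting $u,v$; $H$ is a contraction of $G$ if obtained by a sequence of edge contractions. The diamond is $K_4$ minus an edge. A chord of a cycle $C$ in $G$ is an edge of $G$ joining two vertices of $C$ that are not adjacent in $C$. -}

module Defs where

open import Data.Nat using (ℕ; zero; suc)
open import Data.Fin using (Fin; toℕ) renaming (zero to f0; suc to fs)
open import Data.Bool using (Bool; true; false)
open import Data.Product using (Σ; ∃; _×_; _,_)
open import Data.Sum using (_⊎_)
open import Relation.Nullary using (¬_)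
open import Relation.Binary.PropositionalEquality using (_≡_; _≢_)
open import Relation.Binary.Construct.Closure.ReflexiveTransitive using (Star)

record Graph : Set where
  field
    n      : ℕ
    adj    : Fin n → Fin n → Bool
    sym    : ∀ x y → adj x y ≡ adj y x
    irrefl : ∀ x → adj x x ≡ false
open Graph public

Edge : (G : Graph) → Fin (n G) → Fin (n G) → Set
Edge G x y = adj G x y ≡ true

Connected : Graph → Set
Connected G = ∀ x y → Star (Edge G) x y

record Iso (G H : Graph) : Set where
  field
    to      : Fin (n G) → Fin (n H)
    from    : Fin (n H) → Fin (n G)
    from-to : ∀ x → from (to x) ≡ x
    to-from : ∀ a → to (from a) ≡ a
    pres    : ∀ x y → adj H (to x) (to y) ≡ adj G x y

-- H is (isomorphic to) the graph obtained from G by contracting the edge {u,v}: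
-- f : V(G) → V(H) identifies exactly u and v, is surjective, and
-- a b adjacent in H iff a ≠ b and some x ↦ a, y ↦ b are adjacent in G.
record ContractStep (G H : Graph) : Set where
  field
    u v    : Fin (n G)
    uv     : Edge G u v
    f      : Fin (n G) → Fin (n H)
    merge  : f u ≡ f v
    onlyuv : ∀ x y → f x ≡ f y →
               x ≡ y ⊎ ((x ≡ u ⊎ x ≡ v) × (y ≡ u ⊎ y ≡ v))
    surj   : ∀ a → ∃ λ x → f x ≡ a
    adjH⇒  : ∀ a b → Edge H a b →
               a ≢ b × ∃ λ x → ∃ λ y → f x ≡ a × f y ≡ b × Edge G x y
    ⇒adjH  : ∀ a b → a ≢ b → (∃ λ x → ∃ λ y → f x ≡ a × f y ≡ b × Edge G x y) →
               Edge H a b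

data IsContraction (H : Graph) : Graph → Set₁ where
  done : ∀ {G} → Iso G H → IsContraction H G
  step : ∀ {G G'} → ContractStep G G' → IsContraction H G' → IsContraction H G

diamondAdj : Fin 4 → Fin 4 → Bool
diamondAdj f0 f0 = false
diamondAdj (fs f0) (fs f0) = false
diamondAdj (fs (fs f0)) (fs (fs f0)) = false
diamondAdj (fs (fs (fs f0))) (fs (fs (fs f0))) = false
diamondAdj (fs (fs f0)) (fs (fs (fs f0))) = false
diamondAdj (fs (fs (fs f0))) (fs (fs f0)) = false
diamondAdj _ _ = true

diamondSym : ∀ x y → diamondAdj x y ≡ diamondAdj y x
diamondSym f0 f0 = _≡_.refl
diamondSym f0 (fs f0) = _≡_.refl
diamondSym f0 (fs (fs f0)) = _≡_.refl
diamondSym f0 (fs (fs (fs f0))) = _≡_.refl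
diamondSym (fs f0) f0 = _≡_.refl
diamondSym (fs f0) (fs f0) = _≡_.refl
diamondSym (fs f0) (fs (fs f0)) = _≡_.refl
diamondSym (fs f0) (fs (fs (fs f0))) = _≡_.refl
diamondSym (fs (fs f0)) f0 = _≡_.refl
diamondSym (fs (fs f0)) (fs f0) = _≡_.refl
diamondSym (fs (fs f0)) (fs (fs f0)) = _≡_.refl
diamondSym (fs (fs f0)) (fs (fs (fs f0))) = _≡_.refl
diamondSym (fs (fs (fs f0))) f0 = _≡_.refl
diamondSym (fs (fs (fs f0))) (fs f0) = _≡_.refl
diamondSym (fs (fs (fs f0))) (fs (fs f0)) = _≡_.refl
diamondSym (fs (fs (fs f0))) (fs (fs (fs f0))) = _≡_.refl

diamondIrr : ∀ x → diamondAdj x x ≡ false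
diamondIrr f0 = _≡_.refl
diamondIrr (fs f0) = _≡_.refl
diamondIrr (fs (fs f0)) = _≡_.refl
diamondIrr (fs (fs (fs f0))) = _≡_.refl

Diamond : Graph
Diamond = record { n = 4 ; adj = diamondAdj ; sym = diamondSym ; irrefl = diamondIrr }

CycSucc : (k : ℕ) → Fin k → Fin k → Set
CycSucc k i j = (suc (toℕ i) ≡ toℕ j) ⊎ (suc (toℕ i) ≡ k × toℕ j ≡ 0)

record Cycle (G : Graph) : Set where
  field
    len   : ℕ
    len≥3 : Σ ℕ λ m → len ≡ suc (suc (suc m))
    c     : Fin len → Fin (n G)
    inj   : ∀ i j → c i ≡ c j → i ≡ j
    edges : ∀ i j → CycSucc len i j → Edge G (c i) (c j)
open Cycle public

Chord : (G : Graph) → Cycle G → Set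
Chord G C = Σ (Fin (len C)) λ i → Σ (Fin (len C)) λ j →
  i ≢ j × ¬ CycSucc (len C) i j × ¬ CycSucc (len C) j i × Edge G (c C i) (c C j)

InducedCycle : (G : Graph) → Cycle G → Set
InducedCycle G C = ¬ Chord G C

CompleteOn : (G : Graph) → Cycle G → Set
CompleteOn G C = ∀ i j → i ≢ j → Edge G (c C i) (c C j)

-- Suppose a cycle C has a chord and two non-adjacent vertices p, q. Rotate C so that p comes first.
-- According to whether some chord crosses the pair {p, q}, or joins p to the far side of q, or
-- neither, C can be cut into four consecutive arcs such that some chord joins two opposite arcs
-- while no edge joins the other two. These arcs are the branch sets of a diamond minor: the
-- chord-joined arcs form the hub, the other two the tips. In a connected graph such a minor grows
-- until its branch sets cover every vertex: a new vertex joins a branch set it sees, except that a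
-- vertex seeing both tips but no hub vertex becomes a tip after the branch sets are regrouped (one
-- old tip merges into the hub). Contracting the edges inside the branch sets leaves the diamond.
module Submission where

open import Defs
open import Data.Nat as ℕ using (ℕ; zero; suc; _+_; _∸_; z≤n; s≤s; _<_; _≤_; _<?_; _≤?_; _%_)
open import Data.Nat.DivMod using (%-distribˡ-+; m%n%n≡m%n; [m+n]%n≡m%n; m<n⇒m%n≡m; n%n≡0; m%n<n)
import Data.Nat.Properties as ℕ
open import Data.Fin as Fin using (Fin; toℕ; punchIn; punchOut)
import Data.Fin.Properties as Fin
open import Data.Bool using (Bool; true; false)
import Data.Bool.Properties as Bool
open import Data.Maybe as Maybe using (Maybe; just; nothing; is-nothing)
open import Data.Maybe.Properties using (just-injective; ≡-dec)
open import Data.Fin.Subset using (Subset; _∈_; ∣_∣)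
open import Data.Fin.Subset.Properties using (p⊂q⇒∣p∣<∣q∣)
open import Data.Vec using (tabulate)
open import Data.Vec.Properties using (lookup∘tabulate; []=⇒lookup; lookup⇒[]=)
open import Data.Product using (Σ; ∃; ∃₂; _×_; _,_; proj₁; proj₂)
open import Data.Sum using (_⊎_; inj₁; inj₂; [_,_])
open import Data.Empty using (⊥; ⊥-elim)
open import Function using (_∘_; mk⇔)
open import Function.Definitions using (Injective)
open import Relation.Nullary using (¬_; Dec; yes; no; does; proof; Reflects; invert; contradiction)
open import Relation.Nullary.Decidable using (dec-true; dec-false; does-⇔; map′; _×-dec_; ¬?; decidable-stable)
open import Relation.Unary using (Pred)
open import Relation.Binary using (Rel; Symmetric; Decidable; tri<; tri≈; tri>)
open import Relation.Binary.PropositionalEquality as ≡ hiding (sym; [_])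
open ≡.≡-Reasoning
open import Relation.Binary.Construct.Closure.ReflexiveTransitive
  using (Star; ε; _◅_; _◅◅_; gmap; reverse)

-- The diamond of Defs has hub vertices 0F, 1F and non-adjacent tips 2F, 3F.
pattern 0F = Fin.zero
pattern 1F = Fin.suc 0F
pattern 2F = Fin.suc 1F
pattern 3F = Fin.suc 2F

edge? : (G : Graph) → Decidable (Edge G)
edge? G x y = adj G x y Bool.≟ true

edge-sym : (G : Graph) → Symmetric (Edge G)
edge-sym G {x} {y} e = trans (Graph.sym G y x) e

edge⇒≢ : (G : Graph) → ∀ {x y} → Edge G x y → x ≢ y
edge⇒≢ G {x} e refl with trans (≡.sym e) (irrefl G x)
... | ()

star-exit : ∀ {a p r} {A : Set a} {R : Rel A r} (P : Pred A p) → (∀ x → Dec (P x)) →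
            ∀ {x y} → Star R x y → P x → ¬ P y → ∃₂ λ u v → R u v × P u × ¬ P v
star-exit P P? ε px ¬py = contradiction px ¬py
star-exit P P? (_◅_ {j = z} e s) px ¬py with P? z
... | yes pz = star-exit P P? s pz ¬py
... | no ¬pz = _ , z , e , px , ¬pz

AdjOrEq : Fin 4 → Fin 4 → Set
AdjOrEq i j = i ≡ j ⊎ diamondAdj i j ≡ true

data Tips : Fin 4 → Fin 4 → Set where
  tips₂₃ : Tips 2F 3F
  tips₃₂ : Tips 3F 2F

nonadjacent : ∀ i j → diamondAdj i j ≡ false → i ≡ j ⊎ Tips i j
nonadjacent 0F 0F _ = inj₁ refl
nonadjacent 1F 1F _ = inj₁ refl
nonadjacent 2F 2F _ = inj₁ refl
nonadjacent 3F 3F _ = inj₁ refl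
nonadjacent 2F 3F _ = inj₂ tips₂₃
nonadjacent 3F 2F _ = inj₂ tips₃₂
nonadjacent 0F 1F ()
nonadjacent 0F 2F ()
nonadjacent 0F 3F ()
nonadjacent 1F 0F ()
nonadjacent 1F 2F ()
nonadjacent 1F 3F ()
nonadjacent 2F 0F ()
nonadjacent 2F 1F ()
nonadjacent 3F 0F ()
nonadjacent 3F 1F ()

adjOrEq-unless-tips : ∀ i j → ¬ Tips i j → AdjOrEq i j
adjOrEq-unless-tips i j ¬tips with diamondAdj i j in ij
... | true  = inj₂ refl
... | false with nonadjacent i j ij
...   | inj₁ i≡j  = inj₁ i≡j
...   | inj₂ tips = contradiction tips ¬tips

tips-involve-3F : ∀ {i j} → Tips i j → i ≡ 3F ⊎ j ≡ 3F
tips-involve-3F tips₂₃ = inj₂ refl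
tips-involve-3F tips₃₂ = inj₁ refl

AdjOrEq-sym : ∀ {i j} → AdjOrEq i j → AdjOrEq j i
AdjOrEq-sym (inj₁ i≡j) = inj₁ (≡.sym i≡j)
AdjOrEq-sym {i} {j} (inj₂ ij) = inj₂ (trans (diamondSym j i) ij)

diamondAdj-irrefl : ∀ i → diamondAdj i i ≢ true
diamondAdj-irrefl i e with trans (≡.sym e) (diamondIrr i)
... | ()

BranchEdge : (G : Graph) → (Fin (n G) → Maybe (Fin 4)) → Fin 4 → Rel (Fin (n G)) _
BranchEdge G β i x y = Edge G x y × β x ≡ just i × β y ≡ just i

branchEdge-sym : ∀ {G β i} → Symmetric (BranchEdge G β i)
branchEdge-sym {G} (e , px , py) = edge-sym G e , py , px

-- The branch sets of a diamond minor, as a labelling; nothing marks vertices in no branch set.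
record DiamondModel (G : Graph) : Set where
  field
    branch    : Fin (n G) → Maybe (Fin 4)
    connected : ∀ i x y → branch x ≡ just i → branch y ≡ just i → Star (BranchEdge G branch i) x y
    faithful  : ∀ i j x y → branch x ≡ just i → branch y ≡ just j → Edge G x y → AdjOrEq i j
    realised  : ∀ i j → diamondAdj i j ≡ true →
                ∃₂ λ x y → branch x ≡ just i × branch y ≡ just j × Edge G x y
open DiamondModel

Spanning : ∀ {G} → DiamondModel G → Set
Spanning {G} M = ∀ x → ∃ λ i → branch M x ≡ just i

neighbour : Fin 4 → Fin 4
neighbour 0F = 1F
neighbour _  = 0F

neighbour-adj : ∀ i → diamondAdj i (neighbour i) ≡ true
neighbour-adj 0F = refl
neighbour-adj 1F = refl
neighbour-adj 2F = refl
neighbour-adj 3F = refl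

branch-nonempty : ∀ {G} (M : DiamondModel G) i → ∃ λ x → branch M x ≡ just i
branch-nonempty M i =
  let (x , _ , px , _) = realised M i (neighbour i) (neighbour-adj i) in x , px

module EdgeContraction (m : ℕ) (adjacent : Fin (suc m) → Fin (suc m) → Bool)
  (adjacent-sym : ∀ x y → adjacent x y ≡ adjacent y x)
  (adjacent-irrefl : ∀ x → adjacent x x ≡ false)
  (u v : Fin (suc m)) (uv : adjacent u v ≡ true) where

  G : Graph
  G = record { n = suc m ; adj = adjacent ; sym = adjacent-sym ; irrefl = adjacent-irrefl }

  v≢u : v ≢ u
  v≢u = edge⇒≢ G (edge-sym G uv)

  -- Delete v from the vertex numbering and send v to the image of u.
  squash : Fin (suc m) → Fin m
  squash x with v Fin.≟ x
  ... | yes _  = punchOut v≢u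
  ... | no v≢x = punchOut v≢x

  squash-≢ : ∀ {x} (v≢x : v ≢ x) → squash x ≡ punchOut v≢x
  squash-≢ {x} v≢x with v Fin.≟ x
  ... | yes v≡x = contradiction v≡x v≢x
  ... | no _    = Fin.punchOut-cong v refl

  squash-≡ : ∀ {x} → v ≡ x → squash x ≡ punchOut v≢u
  squash-≡ {x} v≡x with v Fin.≟ x
  ... | yes _   = refl
  ... | no v≢x = contradiction v≡x v≢x

  squash-merges : ∀ x y → squash x ≡ squash y →
                  x ≡ y ⊎ ((x ≡ u ⊎ x ≡ v) × (y ≡ u ⊎ y ≡ v))
  squash-merges x y eq with v Fin.≟ x | v Fin.≟ y
  ... | yes v≡x | yes v≡y = inj₁ (trans (≡.sym v≡x) v≡y)
  ... | yes v≡x | no v≢y  =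
    inj₂ (inj₂ (≡.sym v≡x) , inj₁ (≡.sym (Fin.punchOut-injective v≢u v≢y eq)))
  ... | no v≢x  | yes v≡y = inj₂ (inj₁ (Fin.punchOut-injective v≢x v≢u eq) , inj₂ (≡.sym v≡y))
  ... | no v≢x  | no v≢y  = inj₁ (Fin.punchOut-injective v≢x v≢y eq)

  squash-surjective : ∀ a → ∃ λ x → squash x ≡ a
  squash-surjective a = punchIn v a ,
    trans (squash-≢ (Fin.punchInᵢ≢i v a ∘ ≡.sym)) (Fin.punchOut-punchIn v)

  Joined : Fin m → Fin m → Set
  Joined a b = a ≢ b × ∃₂ λ x y → squash x ≡ a × squash y ≡ b × Edge G x y

  joined? : ∀ a b → Dec (Joined a b)
  joined? a b = ¬? (a Fin.≟ b) ×-dec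
    Fin.any? (λ x → Fin.any? (λ y → (squash x Fin.≟ a) ×-dec (squash y Fin.≟ b) ×-dec edge? G x y))

  joined-sym : ∀ {a b} → Joined a b → Joined b a
  joined-sym (a≢b , x , y , px , py , e) = a≢b ∘ ≡.sym , y , x , py , px , edge-sym G e

  H : Graph
  H = record
    { n      = m
    ; adj    = λ a b → does (joined? a b)
    ; sym    = λ a b → does-⇔ (mk⇔ joined-sym joined-sym) (joined? a b) (joined? b a)
    ; irrefl = λ a → dec-false (joined? a a) (λ j → proj₁ j refl)
    }

  contraction : ContractStep G H
  contraction = record
    { u = u ; v = v ; uv = uv ; f = squash
    ; merge  = trans (squash-≢ v≢u) (≡.sym (squash-≡ refl))
    ; onlyuv = squash-merges
    ; surj   = squash-surjective
    ; adjH⇒  = λ a b e → invert (subst (Reflects (Joined a b)) e (proof (joined? a b)))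
    ; ⇒adjH  = λ a b a≢b j → dec-true (joined? a b) (a≢b , j)
    }

contractEdge : (G : Graph) (u v : Fin (n G)) → Edge G u v →
               Σ Graph λ H → Σ (ContractStep G H) λ cs →
                 n G ≡ suc (n H) × ContractStep.u cs ≡ u × ContractStep.v cs ≡ v
contractEdge record { n = zero } () _ _
contractEdge record { n = suc m ; adj = a ; sym = s ; irrefl = i } u v uv =
  EdgeContraction.H m a s i u v uv , EdgeContraction.contraction m a s i u v uv , refl , refl , refl

module ContractModel {G H : Graph} (cs : ContractStep G H) (M : DiamondModel G)
  (uv-branch : branch M (ContractStep.u cs) ≡ branch M (ContractStep.v cs)) where
  open ContractStep cs

  section : Fin (n H) → Fin (n G)
  section a = proj₁ (surj a)

  β : Fin (n H) → Maybe (Fin 4)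
  β = branch M ∘ section

  to-u : ∀ {y} → y ≡ u ⊎ y ≡ v → branch M y ≡ branch M u
  to-u (inj₁ refl) = refl
  to-u (inj₂ refl) = ≡.sym uv-branch

  β-f : ∀ x → β (f x) ≡ branch M x
  β-f x with onlyuv (section (f x)) x (proj₂ (surj (f x)))
  ... | inj₁ eq       = cong (branch M) eq
  ... | inj₂ (p , q) = trans (to-u p) (≡.sym (to-u q))

  map-walk : ∀ {i x y} → Star (BranchEdge G (branch M) i) x y → Star (BranchEdge H β i) (f x) (f y)
  map-walk ε = ε
  map-walk {i} {x} {z} (_◅_ {j = y} (e , px , py) w) with f x Fin.≟ f y
  ... | yes fx≡fy = subst (λ a → Star (BranchEdge H β i) a (f z)) (≡.sym fx≡fy) (map-walk w)
  ... | no fx≢fy  = (⇒adjH (f x) (f y) fx≢fy (x , y , refl , refl , e) ,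
                     trans (β-f x) px , trans (β-f y) py) ◅ map-walk w

  model : DiamondModel H
  model = record
    { branch    = β
    ; connected = λ i a b pa pb →
        subst₂ (Star (BranchEdge H β i)) (proj₂ (surj a)) (proj₂ (surj b))
          (map-walk (connected M i (section a) (section b) pa pb))
    ; faithful  = λ i j a b pa pb e →
        let (_ , x , y , fx , fy , e′) = adjH⇒ a b e in
        faithful M i j x y (trans (≡.sym (β-f x)) (trans (cong β fx) pa))
                           (trans (≡.sym (β-f y)) (trans (cong β fy) pb)) e′
    ; realised  = λ i j ij →
        let (x , y , px , py , e) = realised M i j ij
            βfx = trans (β-f x) px
            βfy = trans (β-f y) py
            fx≢fy : f x ≢ f y
            fx≢fy eq = diamondAdj-irrefl i
              (subst (λ k → diamondAdj i k ≡ true)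
                 (just-injective (trans (≡.sym βfy) (trans (cong β (≡.sym eq)) βfx))) ij)
        in f x , f y , βfx , βfy , ⇒adjH (f x) (f y) fx≢fy (x , y , refl , refl , e)
    }

  model-spanning : Spanning M → Spanning model
  model-spanning span a = span (section a)

module SpanningModel {G : Graph} (M : DiamondModel G) (span : Spanning M) where

  label : Fin (n G) → Fin 4
  label x = proj₁ (span x)

  branch-label : ∀ x → branch M x ≡ just (label x)
  branch-label x = proj₂ (span x)

  label-≡ : ∀ {x i} → branch M x ≡ just i → label x ≡ i
  label-≡ {x} p = just-injective (trans (≡.sym (branch-label x)) p)

  InternalEdge : Set
  InternalEdge = ∃₂ λ x y → Edge G x y × label x ≡ label y

  internalEdge? : Dec InternalEdge
  internalEdge? = Fin.any? λ x → Fin.any? λ y → edge? G x y ×-dec (label x Fin.≟ label y)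

  -- Branch sets are connected, so a branch set with two vertices contains an edge.
  label-injective : ¬ InternalEdge → Injective _≡_ _≡_ label
  label-injective none {x} {y} eq
    with connected M (label x) x y (branch-label x) (trans (branch-label y) (cong just (≡.sym eq)))
  ... | ε = refl
  ... | (e , _ , pz) ◅ _ = contradiction (x , _ , e , ≡.sym (label-≡ pz)) none

  module _ (none : ¬ InternalEdge) where

    vertex : Fin 4 → Fin (n G)
    vertex i = proj₁ (branch-nonempty M i)

    label-vertex : ∀ i → label (vertex i) ≡ i
    label-vertex i = label-≡ (proj₂ (branch-nonempty M i))

    edge⇒diamond : ∀ x y → Edge G x y → diamondAdj (label x) (label y) ≡ true
    edge⇒diamond x y e with faithful M _ _ x y (branch-label x) (branch-label y) e
    ... | inj₁ eq = contradiction (label-injective none eq) (edge⇒≢ G e)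
    ... | inj₂ d  = d

    diamond⇒edge : ∀ x y → diamondAdj (label x) (label y) ≡ true → Edge G x y
    diamond⇒edge x y d =
      let (x′ , y′ , px′ , py′ , e) = realised M _ _ d in
      subst₂ (Edge G) (label-injective none (label-≡ px′)) (label-injective none (label-≡ py′)) e

    iso : Iso G Diamond
    iso = record
      { to      = label
      ; from    = vertex
      ; from-to = λ x → label-injective none (label-vertex (label x))
      ; to-from = label-vertex
      ; pres    = λ x y → Bool.⇔→≡ (mk⇔ (diamond⇒edge x y) (edge⇒diamond x y))
      }

spanning⇒contraction : ∀ k (G : Graph) → n G ≡ k → (M : DiamondModel G) → Spanning M →
                       IsContraction Diamond G
spanning⇒contraction k G size M span with SpanningModel.internalEdge? M span
... | no none = done (SpanningModel.iso M span none)
spanning⇒contraction zero G size M span | yes (u , _) with subst Fin size u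
... | ()
spanning⇒contraction (suc k) G size M span | yes (u , v , uv , same) with contractEdge G u v uv
... | H , cs , size′ , refl , refl =
  step cs (spanning⇒contraction k H (ℕ.suc-injective (trans (≡.sym size′) size))
             (ContractModel.model cs M uv-branch) (ContractModel.model-spanning cs M uv-branch span))
  where
  open SpanningModel M span using (branch-label)
  uv-branch : branch M u ≡ branch M v
  uv-branch = trans (branch-label u) (trans (cong just same) (≡.sym (branch-label v)))

Unassigned : ∀ {m} {A : Set} → (Fin m → Maybe A) → Subset m
Unassigned β = tabulate (is-nothing ∘ β)

∈-Unassigned : ∀ {m} {A : Set} {β : Fin m → Maybe A} {x} → β x ≡ nothing → x ∈ Unassigned β
∈-Unassigned {x = x} βx = lookup⇒[]= x _ (trans (lookup∘tabulate _ x) (cong is-nothing βx))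

∈-Unassigned⁻ : ∀ {m} {A : Set} {β : Fin m → Maybe A} {x} → x ∈ Unassigned β → β x ≡ nothing
∈-Unassigned⁻ {β = β} {x} x∈
  with β x | trans (≡.sym (lookup∘tabulate (is-nothing ∘ β) x)) ([]=⇒lookup x∈)
... | nothing | _ = refl

∣Unassigned∣-shrinks : ∀ {m} {A : Set} {β β′ : Fin m → Maybe A} {z} →
                       (∀ x → β′ x ≡ nothing → β x ≡ nothing) → β z ≡ nothing → β′ z ≢ nothing →
                       ∣ Unassigned β′ ∣ < ∣ Unassigned β ∣
∣Unassigned∣-shrinks {z = z} keeps βz β′z = p⊂q⇒∣p∣<∣q∣
  ( (λ x∈ → ∈-Unassigned (keeps _ (∈-Unassigned⁻ x∈)))
  , z , ∈-Unassigned βz , β′z ∘ ∈-Unassigned⁻ )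

module Update {G : Graph} (M : DiamondModel G) (z : Fin (n G)) (z-free : branch M z ≡ nothing)
  (l : Fin 4) (ρ : Fin 4 → Fin 4) where

  β : Fin (n G) → Maybe (Fin 4)
  β y with y Fin.≟ z
  ... | yes _ = just l
  ... | no _  = Maybe.map ρ (branch M y)

  β-z : β z ≡ just l
  β-z with z Fin.≟ z
  ... | yes _   = refl
  ... | no z≢z = contradiction refl z≢z

  β-old : ∀ {y i} → branch M y ≡ just i → β y ≡ just (ρ i)
  β-old {y} p with y Fin.≟ z
  ... | yes refl = contradiction (trans (≡.sym p) z-free) λ ()
  ... | no _     = cong (Maybe.map ρ) p

  β⁻¹ : ∀ y {j} → β y ≡ just j →
        (y ≡ z × l ≡ j) ⊎ (∃ λ i → branch M y ≡ just i × ρ i ≡ j)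
  β⁻¹ y p with y Fin.≟ z
  ... | yes y≡z = inj₁ (y≡z , just-injective p)
  ... | no _ with branch M y
  ...   | just i = inj₂ (i , refl , just-injective p)

  map-walk : ∀ {i x y} → Star (BranchEdge G (branch M) i) x y → Star (BranchEdge G β (ρ i)) x y
  map-walk = gmap (λ x → x) (λ { (e , px , py) → e , β-old px , β-old py })

  β-realised : ∀ {i j} → diamondAdj i j ≡ true →
               ∃₂ λ x y → β x ≡ just (ρ i) × β y ≡ just (ρ j) × Edge G x y
  β-realised ij = let (x , y , px , py , e) = realised M _ _ ij in x , y , β-old px , β-old py , e

  unassigned-shrinks : ∣ Unassigned β ∣ < ∣ Unassigned (branch M) ∣
  unassigned-shrinks = ∣Unassigned∣-shrinks keeps z-free (λ p → contradiction (trans (≡.sym β-z) p) λ ())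
    where
    keeps : ∀ x → β x ≡ nothing → branch M x ≡ nothing
    keeps x p with branch M x in eq
    ... | nothing = refl
    ... | just i  = contradiction (trans (≡.sym (β-old eq)) p) λ ()

Sees : ∀ {G} → DiamondModel G → Fin (n G) → Fin 4 → Set
Sees {G} M z i = ∃ λ y → branch M y ≡ just i × Edge G z y

sees? : ∀ {G} (M : DiamondModel G) z i → Dec (Sees M z i)
sees? {G} M z i = Fin.any? λ y → ≡-dec Fin._≟_ (branch M y) (just i) ×-dec edge? G z y

module JoinBranch {G : Graph} (M : DiamondModel G) (z : Fin (n G)) (z-free : branch M z ≡ nothing)
  (l : Fin 4) (w : Fin (n G)) (w∈l : branch M w ≡ just l) (zw : Edge G z w)
  (z-sees : ∀ j → Sees M z j → ¬ Tips l j) where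
  open Update M z z-free l (λ i → i)

  from-z : ∀ y → branch M y ≡ just l → Star (BranchEdge G β l) z y
  from-z y py = (zw , β-z , β-old w∈l) ◅ map-walk (connected M l w y w∈l py)

  connected′ : ∀ i x y → β x ≡ just i → β y ≡ just i → Star (BranchEdge G β i) x y
  connected′ i x y px py with β⁻¹ x px | β⁻¹ y py
  ... | inj₁ (refl , refl)    | inj₁ (refl , _)       = ε
  ... | inj₁ (refl , refl)    | inj₂ (_ , py′ , refl) = from-z y py′
  ... | inj₂ (_ , px′ , refl) | inj₁ (refl , refl)    = reverse (branchEdge-sym {G} {β}) (from-z x px′)
  ... | inj₂ (_ , px′ , refl) | inj₂ (_ , py′ , refl) = map-walk (connected M i x y px′ py′)

  z-adjOrEq : ∀ j y → branch M y ≡ just j → Edge G z y → AdjOrEq l j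
  z-adjOrEq j y py e = adjOrEq-unless-tips l j (z-sees j (y , py , e))

  faithful′ : ∀ i j x y → β x ≡ just i → β y ≡ just j → Edge G x y → AdjOrEq i j
  faithful′ i j x y px py e with β⁻¹ x px | β⁻¹ y py
  ... | inj₁ (refl , refl)    | inj₁ (refl , _)       = contradiction refl (edge⇒≢ G e)
  ... | inj₁ (refl , refl)    | inj₂ (_ , py′ , refl) = z-adjOrEq j y py′ e
  ... | inj₂ (_ , px′ , refl) | inj₁ (refl , refl)    =
          AdjOrEq-sym (z-adjOrEq i x px′ (edge-sym G e))
  ... | inj₂ (_ , px′ , refl) | inj₂ (_ , py′ , refl) = faithful M i j x y px′ py′ e

  model : DiamondModel G
  model = record { branch = β ; connected = connected′ ; faithful = faithful′
                 ; realised = λ i j → β-realised }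

-- Used when z sees only the tips: the old branch sets 0F and 2F merge into the new hub 0F,
-- and z becomes the tip 3F.
recentre : Fin 4 → Fin 4
recentre 0F = 0F
recentre 1F = 2F
recentre 2F = 0F
recentre 3F = 1F

recentre≢3F : ∀ a → recentre a ≢ 3F
recentre≢3F 0F ()
recentre≢3F 1F ()
recentre≢3F 2F ()
recentre≢3F 3F ()

module Recentre {G : Graph} (M : DiamondModel G) (z : Fin (n G)) (z-free : branch M z ≡ nothing)
  (¬sees₀ : ¬ Sees M z 0F) (¬sees₁ : ¬ Sees M z 1F) (sees₂ : Sees M z 2F) (sees₃ : Sees M z 3F) where
  open Update M z z-free 3F recentre

  old : Fin 4 → Fin (n G)
  old a = proj₁ (branch-nonempty M a)

  old∈ : ∀ a → branch M (old a) ≡ just a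
  old∈ a = proj₂ (branch-nonempty M a)

  root : Fin 4 → Fin (n G)
  root 0F = old 0F
  root 1F = old 3F
  root 2F = old 1F
  root 3F = z

  to-root : ∀ a x → branch M x ≡ just a → Star (BranchEdge G β (recentre a)) x (root (recentre a))
  to-root 0F x px = map-walk (connected M 0F x (old 0F) px (old∈ 0F))
  to-root 1F x px = map-walk (connected M 1F x (old 1F) px (old∈ 1F))
  to-root 3F x px = map-walk (connected M 3F x (old 3F) px (old∈ 3F))
  to-root 2F x px =
    let (x₂ , x₀ , p₂ , p₀ , e) = realised M 2F 0F refl in
    map-walk (connected M 2F x x₂ px p₂) ◅◅
    (e , β-old p₂ , β-old p₀) ◅ map-walk (connected M 0F x₀ (old 0F) p₀ (old∈ 0F))

  connected′ : ∀ i x y → β x ≡ just i → β y ≡ just i → Star (BranchEdge G β i) x y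
  connected′ i x y px py with β⁻¹ x px | β⁻¹ y py
  ... | inj₁ (refl , refl)    | inj₁ (refl , _)     = ε
  ... | inj₁ (refl , refl)    | inj₂ (b , _ , σb)   = contradiction σb (recentre≢3F b)
  ... | inj₂ (a , _ , σa)     | inj₁ (refl , refl)  = contradiction σa (recentre≢3F a)
  ... | inj₂ (a , px′ , refl) | inj₂ (b , py′ , σb) =
          to-root a x px′ ◅◅ reverse (branchEdge-sym {G} {β})
            (subst (λ k → Star (BranchEdge G β k) y (root k)) σb (to-root b y py′))

  z-adjOrEq : ∀ b y → branch M y ≡ just b → Edge G z y → AdjOrEq 3F (recentre b)
  z-adjOrEq 0F y py e = contradiction (y , py , e) ¬sees₀
  z-adjOrEq 1F y py e = contradiction (y , py , e) ¬sees₁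
  z-adjOrEq 2F y py e = inj₂ refl
  z-adjOrEq 3F y py e = inj₂ refl

  old-adjOrEq : ∀ a b → AdjOrEq (recentre a) (recentre b)
  old-adjOrEq a b = adjOrEq-unless-tips _ _
    ([ recentre≢3F a , recentre≢3F b ] ∘ tips-involve-3F)

  faithful′ : ∀ i j x y → β x ≡ just i → β y ≡ just j → Edge G x y → AdjOrEq i j
  faithful′ i j x y px py e with β⁻¹ x px | β⁻¹ y py
  ... | inj₁ (refl , refl)    | inj₁ (refl , _)       = contradiction refl (edge⇒≢ G e)
  ... | inj₁ (refl , refl)    | inj₂ (b , py′ , refl) = z-adjOrEq b y py′ e
  ... | inj₂ (a , px′ , refl) | inj₁ (refl , refl)    =
          AdjOrEq-sym (z-adjOrEq a x px′ (edge-sym G e))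
  ... | inj₂ (a , _ , refl)   | inj₂ (b , _ , refl)   = old-adjOrEq a b

  Realised : Fin 4 → Fin 4 → Set
  Realised i j = ∃₂ λ x y → β x ≡ just i × β y ≡ just j × Edge G x y

  swap : ∀ {i j} → Realised i j → Realised j i
  swap (x , y , px , py , e) = y , x , py , px , edge-sym G e

  realised′ : ∀ i j → diamondAdj i j ≡ true → Realised i j
  realised′ 0F 1F _ = β-realised {0F} {3F} refl
  realised′ 0F 2F _ = β-realised {0F} {1F} refl
  realised′ 1F 2F _ = β-realised {3F} {1F} refl
  realised′ 0F 3F _ = let (w , pw , e) = sees₂ in w , z , β-old pw , β-z , edge-sym G e
  realised′ 1F 3F _ = let (w , pw , e) = sees₃ in w , z , β-old pw , β-z , edge-sym G e
  realised′ 1F 0F _ = swap (realised′ 0F 1F refl)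
  realised′ 2F 0F _ = swap (realised′ 0F 2F refl)
  realised′ 2F 1F _ = swap (realised′ 1F 2F refl)
  realised′ 3F 0F _ = swap (realised′ 0F 3F refl)
  realised′ 3F 1F _ = swap (realised′ 1F 3F refl)
  realised′ 0F 0F ()
  realised′ 1F 1F ()
  realised′ 2F 2F ()
  realised′ 3F 3F ()
  realised′ 2F 3F ()
  realised′ 3F 2F ()

  model : DiamondModel G
  model = record { branch = β ; connected = connected′ ; faithful = faithful′ ; realised = realised′ }

Extension : ∀ {G} → DiamondModel G → Set
Extension {G} M = Σ (DiamondModel G) λ M′ → ∣ Unassigned (branch M′) ∣ < ∣ Unassigned (branch M) ∣

join : ∀ {G} (M : DiamondModel G) z → branch M z ≡ nothing →
       ∀ l → Sees M z l → (∀ j → Sees M z j → ¬ Tips l j) → Extension M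
join M z z-free l (w , pw , e) ok =
  JoinBranch.model M z z-free l w pw e ok , Update.unassigned-shrinks M z z-free l (λ i → i)

extend : ∀ {G} (M : DiamondModel G) z → branch M z ≡ nothing → ∀ {i} → Sees M z i → Extension M
extend M z z-free {i} seen with sees? M z 0F | sees? M z 1F | sees? M z 2F | sees? M z 3F
... | yes s₀ | _ | _ | _ = join M z z-free 0F s₀ λ _ _ ()
... | no _ | yes s₁ | _ | _ = join M z z-free 1F s₁ λ _ _ ()
... | no ¬s₀ | no ¬s₁ | yes s₂ | yes s₃ =
  Recentre.model M z z-free ¬s₀ ¬s₁ s₂ s₃ , Update.unassigned-shrinks M z z-free 3F recentre
... | no _ | no _ | yes s₂ | no ¬s₃ = join M z z-free 2F s₂ λ { _ s tips₂₃ → ¬s₃ s }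
... | no _ | no _ | no ¬s₂ | yes s₃ = join M z z-free 3F s₃ λ { _ s tips₃₂ → ¬s₂ s }
... | no ¬s₀ | no ¬s₁ | no ¬s₂ | no ¬s₃ = contradiction seen (unseen i)
  where
  unseen : ∀ i → ¬ Sees M z i
  unseen 0F = ¬s₀
  unseen 1F = ¬s₁
  unseen 2F = ¬s₂
  unseen 3F = ¬s₃

free? : ∀ {G} (M : DiamondModel G) x → Dec (branch M x ≡ nothing)
free? M x = ≡-dec Fin._≟_ (branch M x) nothing

no-free⇒spanning : ∀ {G} (M : DiamondModel G) → ¬ (∃ λ x → branch M x ≡ nothing) → Spanning M
no-free⇒spanning M ¬free x with branch M x in eq
... | just i  = i , refl
... | nothing = contradiction (x , eq) ¬free

free-frontier : ∀ {G} → Connected G → (M : DiamondModel G) → ∀ {z₀} → branch M z₀ ≡ nothing →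
                ∃₂ λ z i → branch M z ≡ nothing × Sees M z i
free-frontier conn M {z₀} z₀-free
  with branch-nonempty M 0F
... | y , y∈ with star-exit (λ x → branch M x ≡ nothing) (free? M) (conn z₀ y) z₀-free
                   (λ p → contradiction (trans (≡.sym p) y∈) λ ())
...   | z , x , zx , z-free , x-taken with branch M x in eq
...     | just i  = z , i , z-free , x , eq , zx
...     | nothing = contradiction refl x-taken

spanning-extension : ∀ k {G} → Connected G → (M : DiamondModel G) → ∣ Unassigned (branch M) ∣ < k →
                     Σ (DiamondModel G) Spanning
spanning-extension (suc k) conn M bound with Fin.any? (free? M)
... | no ¬free = M , no-free⇒spanning M ¬free
... | yes (_ , z₀-free) =
  let (z , _ , z-free , seen) = free-frontier conn M z₀-free
      (M′ , shrinks) = extend M z z-free seen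
  in spanning-extension k conn M′ (ℕ.<-≤-trans shrinks (ℕ.≤-pred bound))

model⇒contraction : (G : Graph) → Connected G → DiamondModel G → IsContraction Diamond G
model⇒contraction G conn M =
  let (M′ , span) = spanning-extension (suc ∣ Unassigned (branch M) ∣) conn M ℕ.≤-refl in
  spanning⇒contraction (n G) G refl M′ span

Consecutive : ℕ → ℕ → ℕ → Set
Consecutive K s t = suc s ≡ t ⊎ (suc s ≡ K × t ≡ 0)

-- A cycle of length k + 1; only W 0, …, W k matter.
record CycleWalk (G : Graph) (k : ℕ) : Set where
  field
    W           : ℕ → Fin (n G)
    W-step      : ∀ t → t < k → Edge G (W t) (W (suc t))
    W-wrap      : Edge G (W k) (W 0)
    W-injective : ∀ s t → s < suc k → t < suc k → W s ≡ W t → s ≡ t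

next : Fin 4 → Fin 4
next 0F = 1F
next 1F = 2F
next 2F = 3F
next 3F = 0F

data RimOrHub (label : Fin 4 → Fin 4) : Fin 4 → Fin 4 → Set where
  hub  : RimOrHub label 0F 1F
  rim  : ∀ r → RimOrHub label (label r) (label (next r))
  flip : ∀ {i j} → RimOrHub label i j → RimOrHub label j i

-- Labels of four cyclically consecutive arcs that go once around the 4-cycle 0F, 2F, 1F, 3F.
record RimLabelling : Set where
  field
    label         : Fin 4 → Fin 4
    unlabel       : Fin 4 → Fin 4
    unlabel-label : ∀ r → unlabel (label r) ≡ r
    covers        : ∀ i j → diamondAdj i j ≡ true → RimOrHub label i j

module Arcs {G : Graph} {k : ℕ} (C : CycleWalk G k) (b₁ b₂ b₃ : ℕ)
  (b₁<b₂ : b₁ < b₂) (b₂<b₃ : b₂ < b₃) (b₃<k : b₃ < k) where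
  open CycleWalk C

  data InArc (t : ℕ) : Fin 4 → Set where
    arc₀ : t ≤ b₁ → InArc t 0F
    arc₁ : b₁ < t → t ≤ b₂ → InArc t 1F
    arc₂ : b₂ < t → t ≤ b₃ → InArc t 2F
    arc₃ : b₃ < t → InArc t 3F

  arc : ℕ → Fin 4
  arc t with t ≤? b₁ | t ≤? b₂ | t ≤? b₃
  ... | yes _ | _     | _     = 0F
  ... | no _  | yes _ | _     = 1F
  ... | no _  | no _  | yes _ = 2F
  ... | no _  | no _  | no _  = 3F

  inArc : ∀ t → InArc t (arc t)
  inArc t with t ≤? b₁ | t ≤? b₂ | t ≤? b₃
  ... | yes p | _     | _     = arc₀ p
  ... | no p  | yes q | _     = arc₁ (ℕ.≰⇒> p) q
  ... | no _  | no p  | yes q = arc₂ (ℕ.≰⇒> p) q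
  ... | no _  | no _  | no p  = arc₃ (ℕ.≰⇒> p)

  arc-≡ : ∀ {t r} → InArc t r → arc t ≡ r
  arc-≡ {t} (arc₀ p) with t ≤? b₁
  ... | yes _ = refl
  ... | no ¬p = contradiction p ¬p
  arc-≡ {t} (arc₁ p q) with t ≤? b₁ | t ≤? b₂
  ... | yes p′ | _     = contradiction p′ (ℕ.<⇒≱ p)
  ... | no _   | yes _ = refl
  ... | no _   | no ¬q = contradiction q ¬q
  arc-≡ {t} (arc₂ p q) with t ≤? b₁ | t ≤? b₂ | t ≤? b₃
  ... | yes p′ | _      | _     = contradiction p′ (ℕ.<⇒≱ (ℕ.<-trans b₁<b₂ p))
  ... | no _   | yes p′ | _     = contradiction p′ (ℕ.<⇒≱ p)
  ... | no _   | no _   | yes _ = refl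
  ... | no _   | no _   | no ¬q = contradiction q ¬q
  arc-≡ {t} (arc₃ p) with t ≤? b₁ | t ≤? b₂ | t ≤? b₃
  ... | yes p′ | _      | _      = contradiction p′ (ℕ.<⇒≱ (ℕ.<-trans (ℕ.<-trans b₁<b₂ b₂<b₃) p))
  ... | no _   | yes p′ | _      = contradiction p′ (ℕ.<⇒≱ (ℕ.<-trans b₂<b₃ p))
  ... | no _   | no _   | yes p′ = contradiction p′ (ℕ.<⇒≱ p)
  ... | no _   | no _   | no _   = refl

  InArc-convex : ∀ {s u t r} → InArc s r → InArc t r → s ≤ u → u ≤ t → InArc u r
  InArc-convex (arc₀ _)   (arc₀ q)   _ u≤t = arc₀ (ℕ.≤-trans u≤t q)
  InArc-convex (arc₁ p _) (arc₁ _ q) s≤u u≤t = arc₁ (ℕ.<-≤-trans p s≤u) (ℕ.≤-trans u≤t q)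
  InArc-convex (arc₂ p _) (arc₂ _ q) s≤u u≤t = arc₂ (ℕ.<-≤-trans p s≤u) (ℕ.≤-trans u≤t q)
  InArc-convex (arc₃ p)   (arc₃ _)   s≤u _   = arc₃ (ℕ.<-≤-trans p s≤u)

  boundary : ∀ r → ∃₂ λ s t → s < suc k × t < suc k × arc s ≡ r × arc t ≡ next r × Edge G (W s) (W t)
  boundary 0F = b₁ , suc b₁ , s≤s (ℕ.<⇒≤ b₁<k) , s≤s b₁<k ,
                arc-≡ (arc₀ ℕ.≤-refl) , arc-≡ (arc₁ ℕ.≤-refl b₁<b₂) , W-step b₁ b₁<k
    where b₁<k = ℕ.<-trans b₁<b₂ (ℕ.<-trans b₂<b₃ b₃<k)
  boundary 1F = b₂ , suc b₂ , s≤s (ℕ.<⇒≤ b₂<k) , s≤s b₂<k ,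
                arc-≡ (arc₁ b₁<b₂ ℕ.≤-refl) , arc-≡ (arc₂ ℕ.≤-refl b₂<b₃) , W-step b₂ b₂<k
    where b₂<k = ℕ.<-trans b₂<b₃ b₃<k
  boundary 2F = b₃ , suc b₃ , s≤s (ℕ.<⇒≤ b₃<k) , s≤s b₃<k ,
                arc-≡ (arc₂ b₂<b₃ ℕ.≤-refl) , arc-≡ (arc₃ ℕ.≤-refl) , W-step b₃ b₃<k
  boundary 3F = k , 0 , ℕ.≤-refl , s≤s z≤n , arc-≡ (arc₃ b₃<k) , arc-≡ (arc₀ z≤n) , W-wrap

  module Labelled (L : RimLabelling) where
    open RimLabelling L

    InArc-label : ∀ {t i} → label (arc t) ≡ i → InArc t (unlabel i)
    InArc-label {t} eq = subst (InArc t) (trans (≡.sym (unlabel-label (arc t))) (cong unlabel eq)) (inArc t)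

    InArc-same : ∀ {t r} → label (arc t) ≡ label r → InArc t r
    InArc-same {t} {r} eq = subst (InArc t) (unlabel-label r) (InArc-label eq)

    position? : ∀ x → Dec (∃ λ (t : Fin (suc k)) → W (toℕ t) ≡ x)
    position? x = Fin.any? λ t → W (toℕ t) Fin.≟ x

    β : Fin (n G) → Maybe (Fin 4)
    β x with position? x
    ... | yes (t , _) = just (label (arc (toℕ t)))
    ... | no _        = nothing

    β-W : ∀ t → t < suc k → β (W t) ≡ just (label (arc t))
    β-W t t<K with position? (W t)
    ... | yes (t′ , eq) = cong (just ∘ label ∘ arc) (W-injective _ _ (Fin.toℕ<n t′) t<K eq)
    ... | no none       = contradiction (Fin.fromℕ< t<K , cong W (Fin.toℕ-fromℕ< t<K)) none

    β⁻¹ : ∀ x {i} → β x ≡ just i → ∃ λ t → t < suc k × W t ≡ x × label (arc t) ≡ i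
    β⁻¹ x p with position? x
    ... | yes (t , eq) = toℕ t , Fin.toℕ<n t , eq , just-injective p
    ... | no _         = contradiction p λ ()

    β-InArc : ∀ {t r} → t < suc k → InArc t r → β (W t) ≡ just (label r)
    β-InArc {t} t<K t∈ = trans (β-W t t<K) (cong (just ∘ label) (arc-≡ t∈))

    arc-walk : ∀ {s t r} → s ≤ t → t < suc k → InArc s r → InArc t r →
               Star (BranchEdge G β (label r)) (W s) (W t)
    arc-walk {t = zero} z≤n _ _ _ = ε
    arc-walk {s} {suc t} s≤t t<K s∈ t∈ with ℕ.m≤n⇒m<n∨m≡n s≤t
    ... | inj₂ refl = ε
    ... | inj₁ s<t =
      let t′<K = ℕ.<-trans (ℕ.n<1+n t) t<K
          t′∈  = InArc-convex s∈ t∈ (ℕ.≤-pred s<t) (ℕ.n≤1+n t)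
      in arc-walk (ℕ.≤-pred s<t) t′<K s∈ t′∈ ◅◅
         (W-step t (ℕ.≤-pred t<K) , β-InArc t′<K t′∈ , β-InArc t<K t∈) ◅ ε

    connected′ : ∀ i x y → β x ≡ just i → β y ≡ just i → Star (BranchEdge G β i) x y
    connected′ i x y px py with β⁻¹ x px | β⁻¹ y py
    ... | s , s<K , refl , refl | t , t<K , refl , lt with ℕ.≤-total s t
    ...   | inj₁ s≤t = arc-walk s≤t t<K (inArc s) (InArc-same lt)
    ...   | inj₂ t≤s = reverse (branchEdge-sym {G} {β})
                         (subst (λ j → Star (BranchEdge G β j) (W t) (W s)) lt
                           (arc-walk t≤s s<K (inArc t) (InArc-same (≡.sym lt))))

    Realised : Fin 4 → Fin 4 → Set
    Realised i j = ∃₂ λ s t → s < suc k × t < suc k × label (arc s) ≡ i × label (arc t) ≡ j ×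
                              Edge G (W s) (W t)

    module _ (chord : Realised 0F 1F)
             (separated : ∀ s t → s < suc k → t < suc k → InArc s (unlabel 2F) → InArc t (unlabel 3F) →
                          ¬ Edge G (W s) (W t)) where

      faithful′ : ∀ i j x y → β x ≡ just i → β y ≡ just j → Edge G x y → AdjOrEq i j
      faithful′ i j x y px py e with β⁻¹ x px | β⁻¹ y py
      ... | s , s<K , refl , ls | t , t<K , refl , lt = adjOrEq-unless-tips i j λ
        { tips₂₃ → separated s t s<K t<K (InArc-label ls) (InArc-label lt) e
        ; tips₃₂ → separated t s t<K s<K (InArc-label lt) (InArc-label ls) (edge-sym G e) }

      realise : ∀ {i j} → RimOrHub label i j → Realised i j
      realise hub      = chord
      realise (rim r)  = let (s , t , s<K , t<K , as , at , e) = boundary r in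
                         s , t , s<K , t<K , cong label as , cong label at , e
      realise (flip d) = let (s , t , s<K , t<K , ls , lt , e) = realise d in
                         t , s , t<K , s<K , lt , ls , edge-sym G e

      model : DiamondModel G
      model = record
        { branch    = β
        ; connected = connected′
        ; faithful  = faithful′
        ; realised  = λ i j ij →
            let (s , t , s<K , t<K , ls , lt , e) = realise (covers i j ij) in
            W s , W t , trans (β-W s s<K) (cong just ls) , trans (β-W t t<K) (cong just lt) , e
        }

-- The hub joins arcs 0 and 2 under rim₀₂, arcs 1 and 3 under rim₁₃; the other two arcs are the tips.
rim₀₂ : RimLabelling
rim₀₂ = record { label = label ; unlabel = label ; unlabel-label = involutive ; covers = covers }
  where
  label : Fin 4 → Fin 4
  label 0F = 0F
  label 1F = 2F
  label 2F = 1F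
  label 3F = 3F

  involutive : ∀ r → label (label r) ≡ r
  involutive 0F = refl
  involutive 1F = refl
  involutive 2F = refl
  involutive 3F = refl

  covers : ∀ i j → diamondAdj i j ≡ true → RimOrHub label i j
  covers 0F 1F _ = hub
  covers 0F 2F _ = rim 0F
  covers 2F 1F _ = rim 1F
  covers 1F 3F _ = rim 2F
  covers 3F 0F _ = rim 3F
  covers 1F 0F _ = flip hub
  covers 2F 0F _ = flip (rim 0F)
  covers 1F 2F _ = flip (rim 1F)
  covers 3F 1F _ = flip (rim 2F)
  covers 0F 3F _ = flip (rim 3F)
  covers 0F 0F ()
  covers 1F 1F ()
  covers 2F 2F ()
  covers 3F 3F ()
  covers 2F 3F ()
  covers 3F 2F ()

rim₁₃ : RimLabelling
rim₁₃ = record { label = label ; unlabel = unlabel ; unlabel-label = unlabel-label ; covers = covers }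
  where
  label : Fin 4 → Fin 4
  label 0F = 2F
  label 1F = 0F
  label 2F = 3F
  label 3F = 1F

  unlabel : Fin 4 → Fin 4
  unlabel 0F = 1F
  unlabel 1F = 3F
  unlabel 2F = 0F
  unlabel 3F = 2F

  unlabel-label : ∀ r → unlabel (label r) ≡ r
  unlabel-label 0F = refl
  unlabel-label 1F = refl
  unlabel-label 2F = refl
  unlabel-label 3F = refl

  covers : ∀ i j → diamondAdj i j ≡ true → RimOrHub label i j
  covers 0F 1F _ = hub
  covers 2F 0F _ = rim 0F
  covers 0F 3F _ = rim 1F
  covers 3F 1F _ = rim 2F
  covers 1F 2F _ = rim 3F
  covers 1F 0F _ = flip hub
  covers 0F 2F _ = flip (rim 0F)
  covers 3F 0F _ = flip (rim 1F)
  covers 1F 3F _ = flip (rim 2F)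
  covers 2F 1F _ = flip (rim 3F)
  covers 0F 0F ()
  covers 1F 1F ()
  covers 2F 2F ()
  covers 3F 3F ()
  covers 2F 3F ()
  covers 3F 2F ()

module GapAndChord {G : Graph} {k : ℕ} (C : CycleWalk G k) (q₀ : ℕ) (q<K : suc q₀ < suc k)
  (gap : ¬ Edge G (CycleWalk.W C 0) (CycleWalk.W C (suc q₀))) where
  open CycleWalk C

  q : ℕ
  q = suc q₀

  0<q₀ : 0 < q₀
  0<q₀ = ℕ.n≢0⇒n>0 λ q₀≡0 →
    gap (subst (λ m → Edge G (W 0) (W (suc m))) (≡.sym q₀≡0)
               (W-step 0 (ℕ.<-≤-trans (s≤s z≤n) (ℕ.≤-pred q<K))))

  q<k : q < k
  q<k = ℕ.≤∧≢⇒< (ℕ.≤-pred q<K) λ q≡k →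
    gap (subst (λ m → Edge G (W 0) (W m)) (≡.sym q≡k) (edge-sym G W-wrap))

  Crossing : ℕ → ℕ → Set
  Crossing x y = 0 < x × x < q × q < y × y ≤ k × Edge G (W x) (W y)

  crossing? : Dec (∃₂ Crossing)
  crossing? = map′
    (λ (x , x<q , y , y<K , 0<x , q<y , e) → x , y , 0<x , x<q , q<y , ℕ.≤-pred y<K , e)
    (λ (x , y , 0<x , x<q , q<y , y≤k , e) → x , x<q , y , s≤s y≤k , 0<x , q<y , e)
    (ℕ.anyUpTo? (λ x → ℕ.anyUpTo? (λ y → (0 <? x) ×-dec (q <? y) ×-dec edge? G (W x) (W y)) (suc k)) q)

  Fan : ℕ → Set
  Fan y = q < y × y < k × Edge G (W 0) (W y)

  fan? : Dec (∃ Fan)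
  fan? = map′ (λ (y , y<k , q<y , e) → y , q<y , y<k , e) (λ (y , q<y , y<k , e) → y , y<k , q<y , e)
    (ℕ.anyUpTo? (λ y → (q <? y) ×-dec edge? G (W 0) (W y)) k)

  crossing-model : ∀ {x y} → Crossing x y → DiamondModel G
  crossing-model {x} {y} (0<x , x<q , q<y , y≤k , e) =
    A.Labelled.model rim₁₃
      (x , y , ℕ.<-trans x<q q<K , s≤s y≤k ,
       cong (RimLabelling.label rim₁₃) (A.arc-≡ (A.arc₁ 0<x (ℕ.≤-pred x<q))) ,
       cong (RimLabelling.label rim₁₃) (A.arc-≡ (A.arc₃ q<y)) , e)
      separated
    where
    module A = Arcs C 0 q₀ q 0<q₀ ℕ.≤-refl q<k
    separated : ∀ s t → s < suc k → t < suc k → A.InArc s 0F → A.InArc t 2F → ¬ Edge G (W s) (W t)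
    separated .0 t _ _ (A.arc₀ z≤n) (A.arc₂ q₀<t t≤q) =
      subst (λ m → ¬ Edge G (W 0) (W m)) (ℕ.≤-antisym q₀<t t≤q) gap

  module _ (¬crossing : ¬ ∃₂ Crossing) where

    fan-model : ∀ {y} → Fan y → DiamondModel G
    fan-model {y} (q<y , y<k , e) =
      A.Labelled.model rim₀₂ (0 , y , s≤s z≤n , ℕ.<-trans y<k (ℕ.n<1+n k) ,
                              cong label (A.arc-≡ (A.arc₀ z≤n)) ,
                              cong label (A.arc-≡ (A.arc₂ q₀<y ℕ.≤-refl)) , e)
        separated
      where
      open RimLabelling rim₀₂ using (label)
      q₀<y = ℕ.<-trans (ℕ.n<1+n q₀) q<y
      module A = Arcs C 0 q₀ y 0<q₀ q₀<y y<k
      separated : ∀ s t → s < suc k → t < suc k → A.InArc s 1F → A.InArc t 3F → ¬ Edge G (W s) (W t)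
      separated s t _ t<K (A.arc₁ 0<s s≤q₀) (A.arc₃ y<t) e′ =
        ¬crossing (s , t , 0<s , s≤s s≤q₀ , ℕ.<-trans q<y y<t , ℕ.≤-pred t<K , e′)

    module _ (¬fan : ¬ ∃ Fan) where

      chord-below : ∀ {i j₀} → i < j₀ → suc j₀ ≤ q → Edge G (W i) (W (suc j₀)) → DiamondModel G
      chord-below {i} {j₀} i<j₀ j≤q e =
        A.Labelled.model rim₀₂ (i , suc j₀ , ℕ.<-trans (ℕ.m<n⇒m<1+n i<j₀) j<K , j<K ,
                                cong label (A.arc-≡ (A.arc₀ ℕ.≤-refl)) ,
                                cong label (A.arc-≡ (A.arc₂ ℕ.≤-refl j≤q)) , e)
          separated
        where
        open RimLabelling rim₀₂ using (label)
        module A = Arcs C i j₀ q i<j₀ j≤q q<k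
        j<K = ℕ.<-trans (s≤s j≤q) (s≤s q<k)
        separated : ∀ s t → s < suc k → t < suc k → A.InArc s 1F → A.InArc t 3F → ¬ Edge G (W s) (W t)
        separated s t _ t<K (A.arc₁ i<s s≤j₀) (A.arc₃ q<t) e′ =
          ¬crossing (s , t , ℕ.≤-<-trans z≤n i<s , ℕ.≤-<-trans s≤j₀ j≤q , q<t , ℕ.≤-pred t<K , e′)

      chord-above : ∀ {i j₀} → q ≤ i → i < j₀ → suc j₀ ≤ k → Edge G (W i) (W (suc j₀)) →
                    DiamondModel G
      chord-above {i} {j₀} q≤i i<j₀ j≤k e =
        A.Labelled.model rim₁₃ (i , suc j₀ , ℕ.<-trans (ℕ.m<n⇒m<1+n i<j₀) (s≤s j≤k) , s≤s j≤k ,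
                                cong label (A.arc-≡ (A.arc₁ q≤i ℕ.≤-refl)) ,
                                cong label (A.arc-≡ (A.arc₃ ℕ.≤-refl)) , e)
          separated
        where
        open RimLabelling rim₁₃ using (label)
        module A = Arcs C q₀ i j₀ q≤i i<j₀ j≤k
        separated : ∀ s t → s < suc k → t < suc k → A.InArc s 0F → A.InArc t 2F → ¬ Edge G (W s) (W t)
        separated zero t _ _ _ (A.arc₂ i<t t≤j₀) e′ =
          ¬fan (t , ℕ.≤-<-trans q≤i i<t , ℕ.≤-<-trans t≤j₀ j≤k , e′)
        separated (suc s) t _ t<K (A.arc₀ s≤q₀) (A.arc₂ i<t t≤j₀) e′ =
          ¬crossing (suc s , t , s≤s z≤n , s≤s s≤q₀ , ℕ.≤-<-trans q≤i i<t , ℕ.≤-pred t<K , e′)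

      chord-across : ∀ {i j} → i < q → q < j → j < suc k → ¬ Consecutive (suc k) j i → ¬ Edge G (W i) (W j)
      chord-across {zero} {j} _ q<j j<K ¬ji e with ℕ.m≤n⇒m<n∨m≡n (ℕ.≤-pred j<K)
      ... | inj₁ j<k = ¬fan (j , q<j , j<k , e)
      ... | inj₂ j≡k = ¬ji (inj₂ (cong suc j≡k , refl))
      chord-across {suc i} {j} i<q q<j j<K _ e = ¬crossing (suc i , j , s≤s z≤n , i<q , q<j , ℕ.≤-pred j<K , e)

      chord-model : ∀ {i j} → i < j → j < suc k → ¬ Consecutive (suc k) i j → ¬ Consecutive (suc k) j i →
                    Edge G (W i) (W j) → DiamondModel G
      chord-model {i} {suc j₀} i<j j<K ¬ij ¬ji e
        with ℕ.≤∧≢⇒< (ℕ.≤-pred i<j) (¬ij ∘ inj₁ ∘ cong suc) | suc j₀ ≤? q | q ≤? i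
      ... | i<j₀ | yes j≤q | _       = chord-below i<j₀ j≤q e
      ... | i<j₀ | no _    | yes q≤i = chord-above q≤i i<j₀ (ℕ.≤-pred j<K) e
      ... | _    | no j≰q  | no q≰i  =
        contradiction e (chord-across (ℕ.≰⇒> q≰i) (ℕ.≰⇒> j≰q) j<K ¬ji)

  model : ∀ {i j} → i < suc k → j < suc k → i ≢ j →
          ¬ Consecutive (suc k) i j → ¬ Consecutive (suc k) j i →
          Edge G (W i) (W j) → DiamondModel G
  model {i} {j} i<K j<K i≢j ¬ij ¬ji e with crossing? | fan? | ℕ.<-cmp i j
  ... | yes (_ , _ , c) | _           | _            = crossing-model c
  ... | no ¬c           | yes (_ , f) | _            = fan-model ¬c f
  ... | no ¬c           | no ¬f       | tri< i<j _ _ = chord-model ¬c ¬f i<j j<K ¬ij ¬ji e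
  ... | no _            | no _        | tri≈ _ i≡j _ = contradiction i≡j i≢j
  ... | no ¬c           | no ¬f       | tri> _ _ j<i = chord-model ¬c ¬f j<i i<K ¬ji ¬ij (edge-sym G e)

module Rotation (k p : ℕ) (p<K : p < suc k) where

  K : ℕ
  K = suc k

  rot : ℕ → ℕ
  rot t = (t + p) % K

  unrot : ℕ → ℕ
  unrot r = (r + (K ∸ p)) % K

  rot<K : ∀ t → rot t < K
  rot<K t = m%n<n (t + p) K

  unrot<K : ∀ r → unrot r < K
  unrot<K r = m%n<n (r + (K ∸ p)) K

  [m%K+n]%K≡[m+n]%K : ∀ m n → (m % K + n) % K ≡ (m + n) % K
  [m%K+n]%K≡[m+n]%K m n = begin
    (m % K + n) % K          ≡⟨ %-distribˡ-+ (m % K) n K ⟩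
    (m % K % K + n % K) % K  ≡⟨ cong (λ x → (x + n % K) % K) (m%n%n≡m%n m K) ⟩
    (m % K + n % K) % K      ≡⟨ %-distribˡ-+ m n K ⟨
    (m + n) % K              ∎

  shift-by-K : ∀ s {a b} → a + b ≡ K → s < K → ((s + a) + b) % K ≡ s
  shift-by-K s {a} {b} a+b≡K s<K = begin
    ((s + a) + b) % K ≡⟨ cong (_% K) (trans (ℕ.+-assoc s a b) (cong (s +_) a+b≡K)) ⟩
    (s + K) % K       ≡⟨ [m+n]%n≡m%n s K ⟩
    s % K             ≡⟨ m<n⇒m%n≡m s<K ⟩
    s                 ∎

  unrot-rot : ∀ {s} → s < K → unrot (rot s) ≡ s
  unrot-rot {s} s<K = trans ([m%K+n]%K≡[m+n]%K (s + p) (K ∸ p))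
                            (shift-by-K s (ℕ.m+[n∸m]≡n (ℕ.<⇒≤ p<K)) s<K)

  rot-unrot : ∀ {r} → r < K → rot (unrot r) ≡ r
  rot-unrot {r} r<K = trans ([m%K+n]%K≡[m+n]%K (r + (K ∸ p)) p)
                            (shift-by-K r (ℕ.m∸n+n≡m (ℕ.<⇒≤ p<K)) r<K)

  rot-injective : ∀ {s t} → s < K → t < K → rot s ≡ rot t → s ≡ t
  rot-injective s<K t<K eq = trans (≡.sym (unrot-rot s<K)) (trans (cong unrot eq) (unrot-rot t<K))

  consecutive⇒ : ∀ {s t} → t < K → Consecutive K s t → suc s % K ≡ t
  consecutive⇒ t<K (inj₁ refl)           = m<n⇒m%n≡m t<K
  consecutive⇒ _   (inj₂ (1+s≡K , refl)) = trans (cong (_% K) 1+s≡K) (n%n≡0 K)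

  ⇒consecutive : ∀ {s t} → s < K → suc s % K ≡ t → Consecutive K s t
  ⇒consecutive {s} s<K eq with ℕ.m≤n⇒m<n∨m≡n s<K
  ... | inj₁ 1+s<K = inj₁ (trans (≡.sym (m<n⇒m%n≡m 1+s<K)) eq)
  ... | inj₂ 1+s≡K = inj₂ (1+s≡K , trans (≡.sym eq) (trans (cong (_% K) 1+s≡K) (n%n≡0 K)))

  rot-consecutive : ∀ {s t} → t < K → Consecutive K s t → Consecutive K (rot s) (rot t)
  rot-consecutive {s} {t} t<K st = ⇒consecutive (rot<K s) (begin
    suc (rot s) % K          ≡⟨ cong (_% K) (ℕ.+-comm 1 (rot s)) ⟩
    (rot s + 1) % K          ≡⟨ [m%K+n]%K≡[m+n]%K (s + p) 1 ⟩
    (s + p + 1) % K          ≡⟨ cong (_% K) (ℕ.+-comm (s + p) 1) ⟩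
    (suc s + p) % K          ≡⟨ [m%K+n]%K≡[m+n]%K (suc s) p ⟨
    (suc s % K + p) % K      ≡⟨ cong (λ x → (x + p) % K) (consecutive⇒ t<K st) ⟩
    rot t                    ∎)

module RotatedCycle {G : Graph} {k : ℕ} (c : Fin (suc k) → Fin (n G))
  (c-injective : ∀ i j → c i ≡ c j → i ≡ j)
  (c-step : ∀ i j → CycSucc (suc k) i j → Edge G (c i) (c j))
  (p : Fin (suc k)) where
  open Rotation k (toℕ p) (Fin.toℕ<n p)

  at : ℕ → Fin K
  at t = Fin.fromℕ< (rot<K t)

  toℕ-at : ∀ t → toℕ (at t) ≡ rot t
  toℕ-at t = Fin.toℕ-fromℕ< (rot<K t)

  consecutive-edge : ∀ {s t} → t < K → Consecutive K s t → Edge G (c (at s)) (c (at t))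
  consecutive-edge {s} {t} t<K st = c-step _ _
    (subst₂ (Consecutive K) (≡.sym (toℕ-at s)) (≡.sym (toℕ-at t)) (rot-consecutive t<K st))

  walk : CycleWalk G k
  walk = record
    { W           = c ∘ at
    ; W-step      = λ t t<k → consecutive-edge (s≤s t<k) (inj₁ refl)
    ; W-wrap      = consecutive-edge (s≤s z≤n) (inj₂ (refl , refl))
    ; W-injective = λ s t s<K t<K eq → rot-injective s<K t<K
        (trans (≡.sym (toℕ-at s)) (trans (cong toℕ (c-injective _ _ eq)) (toℕ-at t)))
    }

  position : Fin K → ℕ
  position a = unrot (toℕ a)

  at-position : ∀ a → at (position a) ≡ a
  at-position a = Fin.toℕ-injective (trans (toℕ-at (position a)) (rot-unrot (Fin.toℕ<n a)))

  position-injective : ∀ {a b} → position a ≡ position b → a ≡ b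
  position-injective {a} {b} eq = trans (≡.sym (at-position a)) (trans (cong at eq) (at-position b))

  position-p : position p ≡ 0
  position-p = trans (cong unrot (≡.sym (m<n⇒m%n≡m (Fin.toℕ<n p)))) (unrot-rot (s≤s z≤n))

  position-consecutive : ∀ {a b} → Consecutive K (position a) (position b) → CycSucc K a b
  position-consecutive {a} {b} ab = subst₂ (Consecutive K) (rot-unrot (Fin.toℕ<n a)) (rot-unrot (Fin.toℕ<n b))
    (rot-consecutive (unrot<K (toℕ b)) ab)

  chord-model : ∀ {q} → p ≢ q → ¬ Edge G (c p) (c q) →
                ∀ {a b} → a ≢ b → ¬ CycSucc K a b → ¬ CycSucc K b a → Edge G (c a) (c b) →
                DiamondModel G
  chord-model {q} p≢q ¬pq {a} {b} a≢b ¬ab ¬ba ab with position q in q-pos | unrot<K (toℕ q)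
  ... | zero   | _   = contradiction (position-injective (trans position-p (≡.sym q-pos))) p≢q
  ... | suc q₀ | q<K =
    GapAndChord.model walk q₀ q<K gap (unrot<K (toℕ a)) (unrot<K (toℕ b))
      (a≢b ∘ position-injective) (¬ab ∘ position-consecutive) (¬ba ∘ position-consecutive)
      (subst₂ (λ x y → Edge G (c x) (c y)) (≡.sym (at-position a)) (≡.sym (at-position b)) ab)
    where
    gap : ¬ Edge G (c (at 0)) (c (at (suc q₀)))
    gap = ¬pq ∘ subst₂ (λ x y → Edge G (c x) (c y))
      (trans (cong at (≡.sym position-p)) (at-position p)) (trans (cong at (≡.sym q-pos)) (at-position q))

NonAdjacentPair : ∀ {G} → Cycle G → Set
NonAdjacentPair {G} C = ∃₂ λ p q → p ≢ q × ¬ Edge G (c C p) (c C q)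

nonAdjacentPair? : ∀ {G} (C : Cycle G) → Dec (NonAdjacentPair C)
nonAdjacentPair? {G} C = Fin.any? λ p → Fin.any? λ q → ¬? (p Fin.≟ q) ×-dec ¬? (edge? G (c C p) (c C q))

chord⇒contraction : ∀ {G} → Connected G → (C : Cycle G) → NonAdjacentPair C → Chord G C →
                    IsContraction Diamond G
chord⇒contraction {G} conn record { len≥3 = _ , refl ; c = v ; inj = v-injective ; edges = v-step }
                  (p , q , p≢q , ¬pq) (a , b , a≢b , ¬ab , ¬ba , ab) =
  model⇒contraction G conn (RotatedCycle.chord-model v v-injective v-step p p≢q ¬pq a≢b ¬ab ¬ba ab)

lemma7 : (G : Graph) → Connected G → ¬ IsContraction Diamond G →
         (C : Cycle G) → InducedCycle G C ⊎ CompleteOn G C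
lemma7 G conn ¬contraction C with nonAdjacentPair? C
... | yes pq  = inj₁ (¬contraction ∘ chord⇒contraction conn C pq)
... | no none = inj₂ λ i j i≢j → decidable-stable (edge? G _ _) λ ¬e → none (i , j , i≢j , ¬e)
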